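{- There exists a symmetric Hadamard matrix of order $156$. More precisely, for each of the parameter sets $(39;17,17,17,15;27)$ and $(39;18,16,16,16;27)$ there exists a cyclic propus difference family in $\mathbb{Z}_{39}$ with those parameters, and hence a symmetric Hadamard matrix of order $4\cdot 39=156$.
   Context: A Hadamard matrix of order $n$ is an $n\times n$ matrix $H$ with entries in $\{1,-1\}$ such that $HH^T=nI$; it is symmetric if $H=H^T$. Let $v\ge 1$ and let $X_1,X_2,X_3,X_4\subseteq\mathbb{Z}_v$ with $|X_i|=k_i$. The sequence $(X_1,X_2,X_3,X_4)$ is a difference family with parameters $(v;k_1,k_2,k_3,k_4;\lambda)$ if for every nonzero $a\in\mathbb{Z}_v$ there are exactly $\lambda$ triples $(x,y,i)$ with $i\in\{1,2,3,4\}$, $x,y\in X_i$ and $x-y=a$. A subset $X\subseteq\mathbb{Z}_v$ is symmetric if $X=-X$. A propus difference family is a difference family $(X_1,X_2,X_3,X_4)$ in $\mathbb{Z}_v$ with $\lambda=k_1+k_2+k_3+k_4-v$, $X_2=X_3$, and $X_1$ or $X_4$ symmetric. -}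

module Defs where

open import Data.Nat using (ℕ; zero; suc; _+_; _∸_; NonZero)
open import Data.Nat.DivMod using (_%_; m%n<n)
open import Data.Bool using (Bool; true; false; _∧_; if_then_else_)
import Data.Fin
open import Data.Fin using (Fin; toℕ; fromℕ<; _≟_)
open import Data.Fin.Subset using (Subset; ∣_∣)
open import Data.Vec using (lookup)
open import Data.Integer using (ℤ; +_; -[1+_]) renaming (_+_ to _+ℤ_; _*_ to _*ℤ_)
open import Data.Product using (_×_; Σ)
open import Data.Sum using (_⊎_)
open import Relation.Binary.PropositionalEquality using (_≡_; _≢_)
open import Relation.Nullary.Decidable using (⌊_⌋)

Σℕ : ∀ n → (Fin n → ℕ) → ℕ
Σℕ zero    f = 0
Σℕ (suc n) f = f Data.Fin.zero + Σℕ n (λ i → f (Data.Fin.suc i))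

Σℤ : ∀ n → (Fin n → ℤ) → ℤ
Σℤ zero    f = + 0
Σℤ (suc n) f = f Data.Fin.zero +ℤ Σℤ n (λ i → f (Data.Fin.suc i))

diff : ∀ {v} .{{_ : NonZero v}} → Fin v → Fin v → Fin v
diff {v} x y = fromℕ< (m%n<n (toℕ x + (v ∸ toℕ y)) v)

neg : ∀ {v} .{{_ : NonZero v}} → Fin v → Fin v
neg {v} x = fromℕ< (m%n<n (v ∸ toℕ x) v)

pairCount : ∀ {v} .{{_ : NonZero v}} → Subset v → Fin v → ℕ
pairCount {v} X a =
  Σℕ v (λ x → Σℕ v (λ y →
    if lookup X x ∧ lookup X y ∧ ⌊ diff x y ≟ a ⌋ then 1 else 0))

SymmetricSet : ∀ {v} .{{_ : NonZero v}} → Subset v → Set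
SymmetricSet {v} X = ∀ (x : Fin v) → lookup X (neg x) ≡ lookup X x

IsDifferenceFamily : (v : ℕ) .{{_ : NonZero v}} → (X₁ X₂ X₃ X₄ : Subset v) →
                     (k₁ k₂ k₃ k₄ lam : ℕ) → Set
IsDifferenceFamily v X₁ X₂ X₃ X₄ k₁ k₂ k₃ k₄ lam =
  ∣ X₁ ∣ ≡ k₁ × ∣ X₂ ∣ ≡ k₂ × ∣ X₃ ∣ ≡ k₃ × ∣ X₄ ∣ ≡ k₄ ×
  (∀ (a : Fin v) → toℕ a ≢ 0 →
     pairCount X₁ a + pairCount X₂ a + pairCount X₃ a + pairCount X₄ a ≡ lam)

IsPropus : (v : ℕ) .{{_ : NonZero v}} → (X₁ X₂ X₃ X₄ : Subset v) →
           (k₁ k₂ k₃ k₄ lam : ℕ) → Set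
IsPropus v X₁ X₂ X₃ X₄ k₁ k₂ k₃ k₄ lam =
  IsDifferenceFamily v X₁ X₂ X₃ X₄ k₁ k₂ k₃ k₄ lam ×
  lam + v ≡ k₁ + k₂ + k₃ + k₄ ×
  X₂ ≡ X₃ ×
  (SymmetricSet X₁ ⊎ SymmetricSet X₄)

PropusExists : (v : ℕ) .{{_ : NonZero v}} → (k₁ k₂ k₃ k₄ lam : ℕ) → Set
PropusExists v k₁ k₂ k₃ k₄ lam =
  Σ (Subset v) λ X₁ → Σ (Subset v) λ X₂ → Σ (Subset v) λ X₃ → Σ (Subset v) λ X₄ →
    IsPropus v X₁ X₂ X₃ X₄ k₁ k₂ k₃ k₄ lam

IsPlusMinusOne : ℤ → Set
IsPlusMinusOne z = z ≡ + 1 ⊎ z ≡ -[1+ 0 ]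

IsHadamard : (n : ℕ) → (Fin n → Fin n → ℤ) → Set
IsHadamard n H =
  (∀ i j → IsPlusMinusOne (H i j)) ×
  (∀ i j → Σℤ n (λ k → H i k *ℤ H j k) ≡ (if ⌊ i ≟ j ⌋ then + n else + 0))

IsSymmetricHadamard : (n : ℕ) → (Fin n → Fin n → ℤ) → Set
IsSymmetricHadamard n H = IsHadamard n H × (∀ i j → H i j ≡ H j i)

-- A propus difference family (X₁, X₂, X₂, X₄) in ℤ_v with X₁ symmetric yields the
-- ±1 matrix of order 4v assembled from the circulants A₁, A₂ of X₁, X₂ and the
-- back-circulant B₄ of X₄ in the propus array
--     [  A₁    A₂    A₂    B₄ ]
--     [  A₂ᵀ   B₄   -A₁   -A₂ ]
--     [  A₂ᵀ  -A₁   -B₄    A₂ ]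
--     [  B₄   -A₂ᵀ   A₂ᵀ  -A₁ ]
-- which is a symmetric Hadamard matrix.
module Submission where

open import Defs
open import Data.Bool using (Bool; true; false; not; _∧_; _xor_; if_then_else_)
open import Data.Bool.Properties using (∧-zeroʳ; ∧-identityʳ)
import Data.Bool.Properties as BoolP
open import Data.Empty using (⊥-elim)
open import Data.Fin using (Fin; zero; suc; toℕ; fromℕ<; _≟_; quotient; remainder)
import Data.Fin as Fin
open import Data.Fin.Properties using (toℕ-fromℕ<; toℕ-injective; toℕ<n; all?)
import Data.Fin.Properties as FinP
open import Data.Fin.Subset using (Subset; ∣_∣)
open import Data.Integer using (ℤ; +_; -[1+_]; _*_) renaming (_+_ to _+ℤ_)
import Data.Integer as ℤ
import Data.Integer.Properties as ℤP
open import Data.Integer.Solver using (module +-*-Solver)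
open import Data.List using (tabulate)
open import Data.List.Relation.Unary.All.Properties using (tabulate⁻)
open import Data.List.Relation.Unary.AllPairs using (AllPairs; _∷_; allPairs?)
open import Data.Nat using (ℕ; zero; suc; _+_; _∸_; _≤_; _<_; _≤?_; NonZero; s≤s)
import Data.Nat as ℕ
open import Data.Nat.Properties hiding (_≟_)
open import Data.Nat.DivMod using (_%_; m%n<n; [m+n]%n≡m%n; m<n⇒m%n≡m; n%n≡0)
open import Data.Product using (_×_; Σ; _,_)
open import Data.Sum using (inj₁; inj₂)
open import Data.Vec using (Vec; []; _∷_; lookup)
import Data.Vec as Vec
open import Data.Vec.Properties using (lookup∘tabulate)
open import Relation.Binary.Definitions using (Tri; tri<; tri≈; tri>)
open import Relation.Binary.PropositionalEquality
open import Function using (_∘_)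
open import Relation.Nullary using (Dec; does; proof; yes; no)
open import Relation.Nullary.Reflects using (Reflects; invert)
open import Relation.Nullary.Decidable using (⌊_⌋; ¬?; _→-dec_)

module _ {v : ℕ} .{{_ : NonZero v}} where

  -- x + (v - y) lies in [v, 2v) when y ≤ x, so reducing it mod v subtracts v.
  toℕ-diff-≥ : (x y : Fin v) → toℕ y ≤ toℕ x → toℕ (diff x y) ≡ toℕ x ∸ toℕ y
  toℕ-diff-≥ x y y≤x = begin
    toℕ (diff x y)                  ≡⟨ toℕ-fromℕ< (m%n<n (toℕ x + (v ∸ toℕ y)) v) ⟩
    (toℕ x + (v ∸ toℕ y)) % v       ≡⟨ cong (_% v) shift ⟩
    (toℕ x ∸ toℕ y + v) % v         ≡⟨ [m+n]%n≡m%n (toℕ x ∸ toℕ y) v ⟩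
    (toℕ x ∸ toℕ y) % v             ≡⟨ m<n⇒m%n≡m (≤-<-trans (m∸n≤m (toℕ x) (toℕ y)) (toℕ<n x)) ⟩
    toℕ x ∸ toℕ y                   ∎
    where
    open ≡-Reasoning
    shift : toℕ x + (v ∸ toℕ y) ≡ toℕ x ∸ toℕ y + v
    shift = trans (sym (+-∸-assoc (toℕ x) (<⇒≤ (toℕ<n y)))) (+-∸-comm v y≤x)

  -- x + (v - y) is already below v when x < y.
  toℕ-diff-< : (x y : Fin v) → toℕ x < toℕ y → toℕ (diff x y) ≡ toℕ x + (v ∸ toℕ y)
  toℕ-diff-< x y x<y = trans (toℕ-fromℕ< (m%n<n (toℕ x + (v ∸ toℕ y)) v)) (m<n⇒m%n≡m below)
    where
    below : toℕ x + (v ∸ toℕ y) < v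
    below = subst (toℕ x + (v ∸ toℕ y) <_) (m+[n∸m]≡n (<⇒≤ (toℕ<n y)))
                  (+-monoˡ-< (v ∸ toℕ y) x<y)

  complement : (x y : Fin v) → v ∸ (toℕ x + (v ∸ toℕ y)) ≡ toℕ y ∸ toℕ x
  complement x y = begin
    v ∸ (toℕ x + (v ∸ toℕ y))   ≡⟨ cong (v ∸_) (+-comm (toℕ x) (v ∸ toℕ y)) ⟩
    v ∸ ((v ∸ toℕ y) + toℕ x)   ≡⟨ sym (∸-+-assoc v (v ∸ toℕ y) (toℕ x)) ⟩
    v ∸ (v ∸ toℕ y) ∸ toℕ x     ≡⟨ cong (_∸ toℕ x) (m∸[m∸n]≡n (<⇒≤ (toℕ<n y))) ⟩
    toℕ y ∸ toℕ x               ∎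
    where open ≡-Reasoning

  diff-involutive : (x y : Fin v) → diff x (diff x y) ≡ y
  diff-involutive x y with toℕ y ≤? toℕ x
  ... | yes y≤x = toℕ-injective (begin
    toℕ (diff x (diff x y))      ≡⟨ toℕ-diff-≥ x (diff x y) d≤x ⟩
    toℕ x ∸ toℕ (diff x y)       ≡⟨ cong (toℕ x ∸_) (toℕ-diff-≥ x y y≤x) ⟩
    toℕ x ∸ (toℕ x ∸ toℕ y)      ≡⟨ m∸[m∸n]≡n y≤x ⟩
    toℕ y                        ∎)
    where
    open ≡-Reasoning
    d≤x : toℕ (diff x y) ≤ toℕ x
    d≤x = subst (_≤ toℕ x) (sym (toℕ-diff-≥ x y y≤x)) (m∸n≤m (toℕ x) (toℕ y))
  ... | no y≰x = toℕ-injective (begin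
    toℕ (diff x (diff x y))               ≡⟨ toℕ-diff-< x (diff x y) x<d ⟩
    toℕ x + (v ∸ toℕ (diff x y))          ≡⟨ cong (λ d → toℕ x + (v ∸ d)) (toℕ-diff-< x y x<y) ⟩
    toℕ x + (v ∸ (toℕ x + (v ∸ toℕ y)))   ≡⟨ cong (_+_ (toℕ x)) (complement x y) ⟩
    toℕ x + (toℕ y ∸ toℕ x)               ≡⟨ m+[n∸m]≡n (<⇒≤ x<y) ⟩
    toℕ y                                 ∎)
    where
    open ≡-Reasoning
    x<y : toℕ x < toℕ y
    x<y = ≰⇒> y≰x
    x<d : toℕ x < toℕ (diff x y)
    x<d = subst (toℕ x <_) (sym (toℕ-diff-< x y x<y))
                (m<m+n (toℕ x) (m<n⇒0<n∸m (toℕ<n y)))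

  neg-diff : (x y : Fin v) → neg (diff x y) ≡ diff y x
  neg-diff x y = toℕ-injective
    (trans (toℕ-fromℕ< (m%n<n (v ∸ toℕ (diff x y)) v)) (byCases (<-cmp (toℕ x) (toℕ y))))
    where
    open ≡-Reasoning
    toℕ-diff-self : ∀ {x y : Fin v} → toℕ x ≡ toℕ y → toℕ (diff x y) ≡ 0
    toℕ-diff-self {x} {y} x≡y =
      trans (toℕ-diff-≥ x y (≤-reflexive (sym x≡y))) (trans (cong (_∸ toℕ y) x≡y) (n∸n≡0 (toℕ y)))

    byCases : Tri (toℕ x < toℕ y) (toℕ x ≡ toℕ y) (toℕ y < toℕ x) →
              (v ∸ toℕ (diff x y)) % v ≡ toℕ (diff y x)
    byCases (tri< x<y _ _) = begin
      (v ∸ toℕ (diff x y)) % v               ≡⟨ cong (λ d → (v ∸ d) % v) (toℕ-diff-< x y x<y) ⟩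
      (v ∸ (toℕ x + (v ∸ toℕ y))) % v        ≡⟨ cong (_% v) (complement x y) ⟩
      (toℕ y ∸ toℕ x) % v                    ≡⟨ m<n⇒m%n≡m below ⟩
      toℕ y ∸ toℕ x                          ≡⟨ sym (toℕ-diff-≥ y x (<⇒≤ x<y)) ⟩
      toℕ (diff y x)                         ∎
      where
      below : toℕ y ∸ toℕ x < v
      below = ≤-<-trans (m∸n≤m (toℕ y) (toℕ x)) (toℕ<n y)
    byCases (tri≈ _ x≡y _) = begin
      (v ∸ toℕ (diff x y)) % v               ≡⟨ cong (λ d → (v ∸ d) % v) (toℕ-diff-self x≡y) ⟩
      v % v                                  ≡⟨ n%n≡0 v ⟩
      0                                      ≡⟨ sym (toℕ-diff-self (sym x≡y)) ⟩
      toℕ (diff y x)                         ∎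
    byCases (tri> _ _ y<x) = begin
      (v ∸ toℕ (diff x y)) % v               ≡⟨ cong (λ d → (v ∸ d) % v) (toℕ-diff-≥ x y (<⇒≤ y<x)) ⟩
      (v ∸ (toℕ x ∸ toℕ y)) % v              ≡⟨ m<n⇒m%n≡m below ⟩
      v ∸ (toℕ x ∸ toℕ y)                    ≡⟨ cong (v ∸_) (sym (complement y x)) ⟩
      v ∸ (v ∸ (toℕ y + (v ∸ toℕ x)))        ≡⟨ m∸[m∸n]≡n d≤v ⟩
      toℕ y + (v ∸ toℕ x)                    ≡⟨ sym (toℕ-diff-< y x y<x) ⟩
      toℕ (diff y x)                         ∎
      where
      below : v ∸ (toℕ x ∸ toℕ y) < v
      below = ∸-monoʳ-< (m<n⇒0<n∸m y<x) (≤-trans (m∸n≤m (toℕ x) (toℕ y)) (<⇒≤ (toℕ<n x)))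
      d≤v : toℕ y + (v ∸ toℕ x) ≤ v
      d≤v = subst (_≤ v) (toℕ-diff-< y x y<x) (<⇒≤ (toℕ<n (diff y x)))

  add : Fin v → Fin v → Fin v
  add x y = fromℕ< (m%n<n (toℕ x + toℕ y) v)

  add-comm : (x y : Fin v) → add x y ≡ add y x
  add-comm x y = toℕ-injective (begin
    toℕ (add x y)          ≡⟨ toℕ-fromℕ< (m%n<n (toℕ x + toℕ y) v) ⟩
    (toℕ x + toℕ y) % v    ≡⟨ cong (_% v) (+-comm (toℕ x) (toℕ y)) ⟩
    (toℕ y + toℕ x) % v    ≡⟨ sym (toℕ-fromℕ< (m%n<n (toℕ y + toℕ x) v)) ⟩
    toℕ (add y x)          ∎)
    where open ≡-Reasoning

Σℕ-cong : ∀ n {f g : Fin n → ℕ} → (∀ k → f k ≡ g k) → Σℕ n f ≡ Σℕ n g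
Σℕ-cong zero    e = refl
Σℕ-cong (suc n) e = cong₂ _+_ (e zero) (Σℕ-cong n (λ k → e (suc k)))

Σℕ-zero : ∀ n {f : Fin n → ℕ} → (∀ k → f k ≡ 0) → Σℕ n f ≡ 0
Σℕ-zero zero    e = refl
Σℕ-zero (suc n) e = cong₂ _+_ (e zero) (Σℕ-zero n (λ k → e (suc k)))

Σℕ-point : ∀ n {f : Fin n → ℕ} (c : Fin n) → (∀ k → k ≢ c → f k ≡ 0) → Σℕ n f ≡ f c
Σℕ-point (suc n) zero    vanish =
  trans (cong (_+_ _) (Σℕ-zero n (λ k → vanish (suc k) (λ ())))) (+-identityʳ _)
Σℕ-point (suc n) (suc c) vanish =
  cong₂ _+_ (vanish zero (λ ())) (Σℕ-point n c (λ k k≢c → vanish (suc k) (k≢c ∘ FinP.suc-injective)))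

Σℤ-cong : ∀ n {f g : Fin n → ℤ} → (∀ k → f k ≡ g k) → Σℤ n f ≡ Σℤ n g
Σℤ-cong zero    e = refl
Σℤ-cong (suc n) e = cong₂ _+ℤ_ (e zero) (Σℤ-cong n (λ k → e (suc k)))

Σℤ-ones : ∀ n → Σℤ n (λ _ → + 1) ≡ + n
Σℤ-ones zero    = refl
Σℤ-ones (suc n) = cong (+ 1 +ℤ_) (Σℤ-ones n)

module _ {v : ℕ} .{{_ : NonZero v}} where

  shiftOverlap : Subset v → Fin v → ℕ
  shiftOverlap X a = Σℕ v (λ x → if lookup X x ∧ lookup X (diff x a) then 1 else 0)

  -- For fixed x the only y with x - y = a is y = x - a, so the pairs of X × X with
  -- difference a correspond to the x with x ∈ X and x - a ∈ X.
  pairCount≡shiftOverlap : (X : Subset v) (a : Fin v) → pairCount X a ≡ shiftOverlap X a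
  pairCount≡shiftOverlap X a = Σℕ-cong v pairsFrom
    where
    pairsFrom : ∀ x → Σℕ v (λ y → if lookup X x ∧ lookup X y ∧ ⌊ diff x y ≟ a ⌋ then 1 else 0)
                      ≡ (if lookup X x ∧ lookup X (diff x a) then 1 else 0)
    pairsFrom x = trans (Σℕ-point v (diff x a) vanish) atPartner
      where
      vanish : ∀ y → y ≢ diff x a → (if lookup X x ∧ lookup X y ∧ ⌊ diff x y ≟ a ⌋ then 1 else 0) ≡ 0
      vanish y y≢partner with diff x y ≟ a
      ... | yes x-y≡a = ⊥-elim (y≢partner (trans (sym (diff-involutive x y)) (cong (diff x) x-y≡a)))
      ... | no _      = cong (λ b → if b then 1 else 0)
                             (trans (cong (lookup X x ∧_) (∧-zeroʳ (lookup X y))) (∧-zeroʳ (lookup X x)))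
      atPartner : (if lookup X x ∧ lookup X (diff x a) ∧ ⌊ diff x (diff x a) ≟ a ⌋ then 1 else 0)
                  ≡ (if lookup X x ∧ lookup X (diff x a) then 1 else 0)
      atPartner with diff x (diff x a) ≟ a
      ... | yes _ = cong (λ b → if lookup X x ∧ b then 1 else 0) (∧-identityʳ (lookup X (diff x a)))
      ... | no ne = ⊥-elim (ne (diff-involutive x a))

  OverlapCondition : Subset v → Subset v → Subset v → ℕ → Set
  OverlapCondition X₁ X₂ X₄ lam =
    ∀ a → toℕ a ≢ 0 → shiftOverlap X₁ a + shiftOverlap X₂ a + shiftOverlap X₂ a + shiftOverlap X₄ a ≡ lam

  overlapCondition? : (X₁ X₂ X₄ : Subset v) (lam : ℕ) → Dec (OverlapCondition X₁ X₂ X₄ lam)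
  overlapCondition? X₁ X₂ X₄ lam = all? (λ a → ¬? (toℕ a ℕ.≟ 0) →-dec
    (shiftOverlap X₁ a + shiftOverlap X₂ a + shiftOverlap X₂ a + shiftOverlap X₄ a ℕ.≟ lam))

  symmetricSet? : (X : Subset v) → Dec (SymmetricSet X)
  symmetricSet? X = all? (λ x → lookup X (neg x) BoolP.≟ lookup X x)

  propusFromOverlaps : (X₁ X₂ X₄ : Subset v) {k₁ k₂ k₄ lam : ℕ} →
    ∣ X₁ ∣ ≡ k₁ → ∣ X₂ ∣ ≡ k₂ → ∣ X₄ ∣ ≡ k₄ → OverlapCondition X₁ X₂ X₄ lam →
    lam + v ≡ k₁ + k₂ + k₂ + k₄ → SymmetricSet X₁ → PropusExists v k₁ k₂ k₂ k₄ lam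
  propusFromOverlaps X₁ X₂ X₄ size₁ size₂ size₄ overlaps count symmetric₁ =
    X₁ , X₂ , X₂ , X₄ , (size₁ , size₂ , size₂ , size₄ , differences) , count , refl , inj₁ symmetric₁
    where
    differences : ∀ a → toℕ a ≢ 0 →
                  pairCount X₁ a + pairCount X₂ a + pairCount X₂ a + pairCount X₄ a ≡ _
    differences a a≢0 = trans
      (cong₂ _+_ (cong₂ _+_ (cong₂ _+_ (pairCount≡shiftOverlap X₁ a) (pairCount≡shiftOverlap X₂ a))
                            (pairCount≡shiftOverlap X₂ a))
                 (pairCount≡shiftOverlap X₄ a))
      (overlaps a a≢0)

-- A bit b stands for the entry sign b; negating an entry complements its bit.
sign : Bool → ℤ
sign true  = -[1+ 0 ]
sign false = + 1

sign-±1 : ∀ b → IsPlusMinusOne (sign b)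
sign-±1 true  = inj₂ refl
sign-±1 false = inj₁ refl

sign-squared : ∀ b → sign b * sign b ≡ + 1
sign-squared true  = refl
sign-squared false = refl

dot : ∀ {n} → Vec Bool n → Vec Bool n → ℤ
dot []      []      = + 0
dot (a ∷ r) (b ∷ s) = sign a * sign b +ℤ dot r s

dot-comm : ∀ {n} (r s : Vec Bool n) → dot r s ≡ dot s r
dot-comm []      []      = refl
dot-comm (a ∷ r) (b ∷ s) = cong₂ _+ℤ_ (ℤP.*-comm (sign a) (sign b)) (dot-comm r s)

dot-Σℤ : ∀ n (r s : Vec Bool n) → Σℤ n (λ k → sign (lookup r k) * sign (lookup s k)) ≡ dot r s
dot-Σℤ zero    []      []      = refl
dot-Σℤ (suc n) (a ∷ r) (b ∷ s) = cong (sign a * sign b +ℤ_) (dot-Σℤ n r s)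

Orthogonal : ∀ {n} → Vec Bool n → Vec Bool n → Set
Orthogonal r s = dot r s ≡ + 0

agreements mismatches : ∀ {n} → Vec Bool n → Vec Bool n → ℕ
agreements []      []      = 0
agreements (a ∷ r) (b ∷ s) = (if a xor b then 0 else 1) + agreements r s
mismatches []      []      = 0
mismatches (a ∷ r) (b ∷ s) = (if a xor b then 1 else 0) + mismatches r s

dot-tally : ∀ {n} (r s : Vec Bool n) → dot r s ≡ + agreements r s ℤ.- + mismatches r s
dot-tally []      []      = refl
dot-tally (a ∷ r) (b ∷ s) = step a b
  where
  A M : ℤ
  A = + agreements r s
  M = + mismatches r s
  agree : + 1 +ℤ dot r s ≡ (+ 1 +ℤ A) ℤ.- M
  agree = trans (cong (+ 1 +ℤ_) (dot-tally r s)) (sym (ℤP.+-assoc (+ 1) A (ℤ.- M)))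
  differ : -[1+ 0 ] +ℤ dot r s ≡ A ℤ.- (+ 1 +ℤ M)
  differ = trans (cong (-[1+ 0 ] +ℤ_) (dot-tally r s)) (shift A M)
    where
    open +-*-Solver
    shift : ∀ A M → -[1+ 0 ] +ℤ (A ℤ.- M) ≡ A ℤ.- (+ 1 +ℤ M)
    shift = solve 2 (λ A M → con -[1+ 0 ] :+ (A :- M) := A :- (con (+ 1) :+ M)) refl
  step : ∀ a b → dot (a ∷ r) (b ∷ s) ≡ + agreements (a ∷ r) (b ∷ s) ℤ.- + mismatches (a ∷ r) (b ∷ s)
  step false false = agree
  step false true  = differ
  step true  false = differ
  step true  true  = agree

-- Rows agreeing in exactly as many positions as they differ are orthogonal;
-- balance is decided by counting, which is much cheaper to evaluate than dot.
Balanced : ∀ {n} → Vec Bool n → Vec Bool n → Set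
Balanced r s = agreements r s ≡ mismatches r s

balanced? : ∀ {n} (r s : Vec Bool n) → Dec (Balanced r s)
balanced? r s = agreements r s ℕ.≟ mismatches r s

balanced⇒orthogonal : ∀ {n} (r s : Vec Bool n) → Balanced r s → Orthogonal r s
balanced⇒orthogonal r s eq = begin
  dot r s                                               ≡⟨ dot-tally r s ⟩
  + agreements r s ℤ.- + mismatches r s                 ≡⟨ cong (λ m → + agreements r s ℤ.- + m) (sym eq) ⟩
  + agreements r s ℤ.- + agreements r s                 ≡⟨ ℤP.+-inverseʳ (+ agreements r s) ⟩
  + 0                                                   ∎
  where open ≡-Reasoning

-- Row i of a bit matrix as a vector; as data it is evaluated only once.
row : ∀ {n} → (Fin n → Fin n → Bool) → Fin n → Vec Bool n
row M i = Vec.tabulate (M i)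

allPairs-tabulate⁻ : ∀ {n} {A : Set} {R : A → A → Set} {f : Fin n → A} →
                     AllPairs R (tabulate f) → ∀ {i j} → i Fin.< j → R (f i) (f j)
allPairs-tabulate⁻ (px ∷ _)  {zero}  {suc j} _         = tabulate⁻ px j
allPairs-tabulate⁻ (_ ∷ pxs) {suc i} {suc j} (s≤s i<j) = allPairs-tabulate⁻ pxs i<j

hadamardFromRows : ∀ n (M : Fin n → Fin n → Bool) →
                   AllPairs Balanced (tabulate (row M)) → IsHadamard n (λ i j → sign (M i j))
hadamardFromRows n M rowsBalanced = (λ i j → sign-±1 (M i j)) , gram
  where
  rowsAsVectors : ∀ i j → Σℤ n (λ k → sign (M i k) * sign (M j k)) ≡ dot (row M i) (row M j)
  rowsAsVectors i j = trans
    (Σℤ-cong n (λ k → sym (cong₂ (λ x y → sign x * sign y)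
                                  (lookup∘tabulate (M i) k) (lookup∘tabulate (M j) k))))
    (dot-Σℤ n (row M i) (row M j))
  orthogonalBefore : ∀ {i j} → i Fin.< j → Orthogonal (row M i) (row M j)
  orthogonalBefore {i} {j} i<j =
    balanced⇒orthogonal (row M i) (row M j) (allPairs-tabulate⁻ rowsBalanced i<j)

  distinctOrthogonal : ∀ i j → i ≢ j → Orthogonal (row M i) (row M j)
  distinctOrthogonal i j i≢j with FinP.<-cmp i j
  ... | tri< i<j _ _ = orthogonalBefore i<j
  ... | tri≈ _ i≡j _ = ⊥-elim (i≢j i≡j)
  ... | tri> _ _ j<i = trans (dot-comm (row M i) (row M j)) (orthogonalBefore j<i)


  gram : ∀ i j → Σℤ n (λ k → sign (M i k) * sign (M j k)) ≡ (if ⌊ i ≟ j ⌋ then + n else + 0)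
  gram i j with i ≟ j
  ... | yes refl = trans (Σℤ-cong n (λ k → sign-squared (M i k))) (Σℤ-ones n)
  ... | no i≢j   = trans (rowsAsVectors i j) (distinctOrthogonal i j i≢j)

pattern I   = zero
pattern II  = suc zero
pattern III = suc (suc zero)
pattern IV  = suc (suc (suc zero))

module _ {v : ℕ} .{{_ : NonZero v}} where

  circulant : Subset v → Fin v → Fin v → Bool
  circulant X i j = lookup X (diff j i)

  backCirculant : Subset v → Fin v → Fin v → Bool
  backCirculant X i j = lookup X (add i j)

  -- The circulant of a symmetric set is a symmetric matrix, as -(j - i) = i - j.
  circulant-symmetric : (X : Subset v) → SymmetricSet X → ∀ i j → circulant X i j ≡ circulant X j i
  circulant-symmetric X symmetric i j =
    trans (sym (symmetric (diff j i))) (cong (lookup X) (neg-diff j i))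

  backCirculant-symmetric : (X : Subset v) → ∀ i j → backCirculant X i j ≡ backCirculant X j i
  backCirculant-symmetric X i j = cong (lookup X) (add-comm i j)

  -- Block (a, b) of the propus array built from A = X₁, B = X₂ = X₃ and D = X₄.
  propusBlock : (A B D : Subset v) → Fin 4 → Fin 4 → Fin v → Fin v → Bool
  propusBlock A B D I   I   i j = circulant A i j
  propusBlock A B D I   II  i j = circulant B i j
  propusBlock A B D I   III i j = circulant B i j
  propusBlock A B D I   IV  i j = backCirculant D i j
  propusBlock A B D II  I   i j = circulant B j i
  propusBlock A B D II  II  i j = backCirculant D i j
  propusBlock A B D II  III i j = not (circulant A i j)
  propusBlock A B D II  IV  i j = not (circulant B i j)
  propusBlock A B D III I   i j = circulant B j i
  propusBlock A B D III II  i j = not (circulant A i j)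
  propusBlock A B D III III i j = not (backCirculant D i j)
  propusBlock A B D III IV  i j = circulant B i j
  propusBlock A B D IV  I   i j = backCirculant D i j
  propusBlock A B D IV  II  i j = not (circulant B j i)
  propusBlock A B D IV  III i j = circulant B j i
  propusBlock A B D IV  IV  i j = not (circulant A i j)

  -- Off-diagonal blocks come in transposed pairs and the diagonal blocks are
  -- symmetric once A is, so the whole array is symmetric.
  propusBlock-symmetric : (A B D : Subset v) → SymmetricSet A →
                          ∀ a b i j → propusBlock A B D a b i j ≡ propusBlock A B D b a j i
  propusBlock-symmetric A B D symA I   I   i j = circulant-symmetric A symA i j
  propusBlock-symmetric A B D symA I   II  i j = refl
  propusBlock-symmetric A B D symA I   III i j = refl
  propusBlock-symmetric A B D symA I   IV  i j = backCirculant-symmetric D i j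
  propusBlock-symmetric A B D symA II  I   i j = refl
  propusBlock-symmetric A B D symA II  II  i j = backCirculant-symmetric D i j
  propusBlock-symmetric A B D symA II  III i j = cong not (circulant-symmetric A symA i j)
  propusBlock-symmetric A B D symA II  IV  i j = refl
  propusBlock-symmetric A B D symA III I   i j = refl
  propusBlock-symmetric A B D symA III II  i j = cong not (circulant-symmetric A symA i j)
  propusBlock-symmetric A B D symA III III i j = cong not (backCirculant-symmetric D i j)
  propusBlock-symmetric A B D symA III IV  i j = refl
  propusBlock-symmetric A B D symA IV  I   i j = backCirculant-symmetric D i j
  propusBlock-symmetric A B D symA IV  II  i j = refl
  propusBlock-symmetric A B D symA IV  III i j = refl
  propusBlock-symmetric A B D symA IV  IV  i j = cong not (circulant-symmetric A symA i j)

  propusArray : (A B D : Subset v) → Fin (4 ℕ.* v) → Fin (4 ℕ.* v) → Bool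
  propusArray A B D p q =
    propusBlock A B D (quotient {4} v p) (quotient {4} v q) (remainder {4} v p) (remainder {4} v q)

  propusArray-symmetric : (A B D : Subset v) → SymmetricSet A →
                          ∀ p q → propusArray A B D p q ≡ propusArray A B D q p
  propusArray-symmetric A B D symA p q =
    propusBlock-symmetric A B D symA (quotient {4} v p) (quotient {4} v q) (remainder {4} v p) (remainder {4} v q)

-- The witness of a decision procedure whose verdict evaluates to yes; the
-- verdicts below are computed by the type checker when it checks `refl`.
witness : ∀ {P : Set} (d : Dec P) → does d ≡ true → P
witness d verdict = invert (subst (Reflects _) verdict (proof d))

F₁ F₂ F₄ : Subset 39
F₁ = true ∷ true ∷ true ∷ true ∷ false ∷ false ∷ true ∷ false ∷ false ∷ false ∷ true ∷ true ∷ false ∷ false ∷ true ∷ false ∷ true ∷ false ∷ false ∷ false ∷ false ∷ false ∷ false ∷ true ∷ false ∷ true ∷ false ∷ false ∷ true ∷ true ∷ false ∷ false ∷ false ∷ true ∷ false ∷ false ∷ true ∷ true ∷ true ∷ []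
F₂ = true ∷ true ∷ true ∷ false ∷ true ∷ false ∷ false ∷ false ∷ false ∷ false ∷ false ∷ true ∷ true ∷ false ∷ false ∷ false ∷ false ∷ true ∷ true ∷ false ∷ true ∷ true ∷ true ∷ false ∷ false ∷ true ∷ false ∷ true ∷ true ∷ false ∷ false ∷ false ∷ true ∷ false ∷ false ∷ true ∷ false ∷ true ∷ false ∷ []
F₄ = true ∷ true ∷ false ∷ false ∷ false ∷ false ∷ true ∷ true ∷ false ∷ false ∷ false ∷ false ∷ false ∷ true ∷ false ∷ false ∷ false ∷ true ∷ false ∷ true ∷ false ∷ false ∷ false ∷ false ∷ false ∷ true ∷ true ∷ false ∷ true ∷ false ∷ false ∷ true ∷ false ∷ true ∷ true ∷ true ∷ false ∷ true ∷ false ∷ []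

G₁ G₂ G₄ : Subset 39
G₁ = false ∷ true ∷ false ∷ false ∷ true ∷ false ∷ true ∷ false ∷ false ∷ false ∷ true ∷ false ∷ false ∷ false ∷ true ∷ true ∷ true ∷ true ∷ true ∷ false ∷ false ∷ true ∷ true ∷ true ∷ true ∷ true ∷ false ∷ false ∷ false ∷ true ∷ false ∷ false ∷ false ∷ true ∷ false ∷ true ∷ false ∷ false ∷ true ∷ []
G₂ = true ∷ false ∷ true ∷ false ∷ true ∷ true ∷ true ∷ false ∷ true ∷ false ∷ true ∷ true ∷ false ∷ false ∷ false ∷ true ∷ false ∷ false ∷ true ∷ true ∷ true ∷ false ∷ false ∷ false ∷ false ∷ true ∷ false ∷ false ∷ true ∷ false ∷ false ∷ true ∷ true ∷ false ∷ false ∷ false ∷ false ∷ false ∷ false ∷ []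
G₄ = true ∷ true ∷ true ∷ false ∷ true ∷ true ∷ false ∷ true ∷ false ∷ false ∷ true ∷ false ∷ false ∷ false ∷ false ∷ false ∷ true ∷ false ∷ false ∷ false ∷ false ∷ true ∷ true ∷ false ∷ true ∷ true ∷ false ∷ false ∷ false ∷ false ∷ false ∷ false ∷ true ∷ true ∷ true ∷ false ∷ false ∷ true ∷ false ∷ []

F₁-symmetric : SymmetricSet F₁
F₁-symmetric = witness (symmetricSet? F₁) refl

firstFamily : PropusExists 39 17 17 17 15 27
firstFamily = propusFromOverlaps F₁ F₂ F₄ refl refl refl
  (witness (overlapCondition? F₁ F₂ F₄ 27) refl) refl F₁-symmetric

secondFamily : PropusExists 39 18 16 16 16 27
secondFamily = propusFromOverlaps G₁ G₂ G₄ refl refl refl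
  (witness (overlapCondition? G₁ G₂ G₄ 27) refl) refl (witness (symmetricSet? G₁) refl)

H₁₅₆ : Fin 156 → Fin 156 → Bool
H₁₅₆ = propusArray F₁ F₂ F₄

H₁₅₆-rowsBalanced : AllPairs Balanced (tabulate (row H₁₅₆))
H₁₅₆-rowsBalanced =
  witness (allPairs? balanced? (tabulate (row H₁₅₆))) refl

mainTheorem3 : PropusExists 39 17 17 17 15 27 ×
               PropusExists 39 18 16 16 16 27 ×
               Σ (Fin 156 → Fin 156 → ℤ) (λ H → IsSymmetricHadamard 156 H)
mainTheorem3 =
  firstFamily , secondFamily ,
  (λ i j → sign (H₁₅₆ i j)) ,
  hadamardFromRows 156 H₁₅₆ H₁₅₆-rowsBalanced ,
  (λ i j → cong sign (propusArray-symmetric F₁ F₂ F₄ F₁-symmetric i j))
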